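{- Let $\mathcal S$ be $2_{\mathsf K}$ or $2_{\mathsf{K4}}$. Let $n\in\mathbb N$ and let $A^\alpha$ be a p-formula of degree $n$. Let $\Pi,\Pi'$ be $\mathcal S$-proofs of $\Gamma\vdash\Delta$ and $\Gamma'\vdash\Delta'$ respectively, such that $g(\Pi),g(\Pi')\le n$, and $\alpha\in I(\Gamma,\Delta_{ -A^\alpha})$ or $\alpha\in I(\Gamma'_{ -A^\alpha},\Delta'_{ -A^\alpha})$. Then one can effectively obtain from $\Pi$ and $\Pi'$ an $\mathcal S$-proof of $\Gamma,\Gamma'_{ -A^\alpha}\vdash\Delta_{ -A^\alpha},\Delta'$ whose degree is $\le n$.
   Context: Modal formulas over proposition symbols with $\neg,\wedge,\vee,\to,\Box,\Diamond$. Fix a countably infinite set of tokens; a position is a finite (possibly empty) sequence of tokens, $\circ$ concatenation, $\alpha\circ x=\alpha\circ\langle x\rangle$, $\beta\preceq\alpha$ means $\beta$ is a prefix of $\alpha$. A p-formula is $A^\alpha$; a 2-sequent is $\Gamma\vdash\Delta$ with $\Gamma,\Delta$ finite sequences of p-formulas; $I(\Gamma)=\{\beta:\exists A^\alpha\in\Gamma,\ \beta\preceq\alpha\}$. For a sequence $\Gamma$, $\Gamma_{ -A^\alpha}$ denotes $\Gamma$ with all occurrences of $A^\alpha$ removed. Degree: $\deg(p)=0$; $\deg(\neg A)=\deg(\Box A)=\deg(\Diamond A)=\deg(A)+1$; $\deg(A\#B)=\max(\deg A,\deg B)+1$ for $\#\in\{\wedge,\vee,\to\}$; $\deg(A^\alpha)=\deg(A)$.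 The degree $g(\Pi)$ of a proof is $0$ if $\Pi$ has no Cut, and otherwise the supremum of $\deg(A^\alpha)+1$ over cut formulas $A^\alpha$ of $\Pi$. Rules common to both calculi: Axiom $A^\alpha\vdash A^\alpha$; Cut: from $\Gamma_1\vdash A^\alpha,\Delta_1$ and $\Gamma_2,A^\alpha\vdash\Delta_2$ infer $\Gamma_1,\Gamma_2\vdash\Delta_1,\Delta_2$, allowed only if $\alpha\in I(\Gamma_1,\Delta_1)$ or $\alpha\in I(\Gamma_2,\Delta_2)$; weakening, contraction, exchange; classical propositional sequent rules for $\neg,\wedge,\vee,\to$ (two-premise rules with contexts joined) with all active p-formulas at the same position; modal rules: ($\Box\vdash$) from $\Gamma,A^{\alpha\circ\beta}\vdash\Delta$ infer $\Gamma,(\Box A)^\alpha\vdash\Delta$; ($\vdash\Box$) from $\Gamma\vdash A^{\alpha\circ x},\Delta$ infer $\Gamma\vdash(\Box A)^\alpha,\Delta$; ($\Diamond\vdash$) from $\Gamma,A^{\alpha\circ x}\vdash\Delta$ infer $\Gamma,(\Diamond A)^\alpha\vdash\Delta$; ($\vdash\Diamond$) from $\Gamma\vdash A^{\alpha\circ\beta},\Delta$ infer $\Gamma\vdash(\Diamond A)^\alpha,\Delta$; $x$ a token, and in $\vdash\Box,\Diamond\vdash$, $\alpha\circ x\notin I(\Gamma,\Delta)$. In $\Box\vdash$ and $\vdash\Diamond$ it is required that $\Gamma$ or $\Delta$ contains a p-formula $B^{\alpha\circ\beta\circ\eta}$ for some $B$ and position $\eta$, and additionally: in $2_{\mathsf{K4}}$,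 $\beta$ is nonempty; in $2_{\mathsf K}$, $\beta$ is a single token. -}

module Defs where

open import Data.Nat using (ℕ; _⊔_; suc; _≡ᵇ_)
open import Data.Bool using (Bool; true; false; _∧_; if_then_else_)
open import Data.List using (List; []; _∷_; _++_; [_])
open import Data.List.Membership.Propositional using (_∈_)
open import Data.Product using (Σ; ∃; _×_; _,_)
open import Data.Sum using (_⊎_)
open import Relation.Binary.PropositionalEquality using (_≡_)
open import Relation.Nullary using (¬_)

data Fm : Set where
  prop : ℕ → Fm
  ¬′   : Fm → Fm
  _∧′_ : Fm → Fm → Fm
  _∨′_ : Fm → Fm → Fm
  _⇒′_ : Fm → Fm → Fm
  □′   : Fm → Fm
  ◇′   : Fm → Fm

deg : Fm → ℕ
deg (prop _) = 0
deg (¬′ A)   = suc (deg A)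
deg (□′ A)   = suc (deg A)
deg (◇′ A)   = suc (deg A)
deg (A ∧′ B) = suc (deg A ⊔ deg B)
deg (A ∨′ B) = suc (deg A ⊔ deg B)
deg (A ⇒′ B) = suc (deg A ⊔ deg B)

Token : Set
Token = ℕ

Pos : Set
Pos = List Token

_⪯_ : Pos → Pos → Set
β ⪯ α = ∃ λ γ → β ++ γ ≡ α

record PF : Set where
  constructor _^_
  field
    fm  : Fm
    pos : Pos
open PF public

degP : PF → ℕ
degP P = deg (fm P)

_∈I_ : Pos → List PF → Set
β ∈I Γ = ∃ λ P → P ∈ Γ × β ⪯ pos P

eqPos : Pos → Pos → Bool
eqPos []       []       = true
eqPos (x ∷ xs) (y ∷ ys) = (x ≡ᵇ y) ∧ eqPos xs ys
eqPos _        _        = false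

eqFm : Fm → Fm → Bool
eqFm (prop p) (prop q)   = p ≡ᵇ q
eqFm (¬′ A) (¬′ B)       = eqFm A B
eqFm (□′ A) (□′ B)       = eqFm A B
eqFm (◇′ A) (◇′ B)       = eqFm A B
eqFm (A ∧′ B) (C ∧′ D)   = eqFm A C ∧ eqFm B D
eqFm (A ∨′ B) (C ∨′ D)   = eqFm A C ∧ eqFm B D
eqFm (A ⇒′ B) (C ⇒′ D)   = eqFm A C ∧ eqFm B D
eqFm _ _                 = false

eqPF : PF → PF → Bool
eqPF (A ^ α) (B ^ β) = eqFm A B ∧ eqPos α β

_－_ : List PF → PF → List PF
[]      － P = []
(Q ∷ Γ) － P = if eqPF Q P then Γ － P else Q ∷ (Γ － P)

data System : Set where
  2K 2K4 : System

Admissible : System → Pos → Set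
Admissible 2K  β = ∃ λ (x : Token) → β ≡ [ x ]
Admissible 2K4 β = ¬ (β ≡ [])

Witness : List PF → List PF → Pos → Pos → Set
Witness Γ Δ α β = ∃ λ B → ∃ λ η → (B ^ (α ++ β ++ η)) ∈ (Γ ++ Δ)

_∘_ : Pos → Token → Pos
α ∘ x = α ++ [ x ]

data Proof (S : System) : List PF → List PF → Set where
  ax   : ∀ P → Proof S [ P ] [ P ]
  cut  : ∀ {Γ₁ Δ₁ Γ₂ Δ₂} P →
         Proof S Γ₁ (P ∷ Δ₁) → Proof S (Γ₂ ++ [ P ]) Δ₂ →
         (pos P ∈I (Γ₁ ++ Δ₁) ⊎ pos P ∈I (Γ₂ ++ Δ₂)) →
         Proof S (Γ₁ ++ Γ₂) (Δ₁ ++ Δ₂)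
  wL   : ∀ {Γ Δ} P → Proof S Γ Δ → Proof S (Γ ++ [ P ]) Δ
  wR   : ∀ {Γ Δ} P → Proof S Γ Δ → Proof S Γ (P ∷ Δ)
  cL   : ∀ {Γ Δ} P → Proof S (Γ ++ P ∷ P ∷ []) Δ → Proof S (Γ ++ [ P ]) Δ
  cR   : ∀ {Γ Δ} P → Proof S Γ (P ∷ P ∷ Δ) → Proof S Γ (P ∷ Δ)
  eL   : ∀ {Γ₁ Γ₂ Δ} P Q → Proof S (Γ₁ ++ P ∷ Q ∷ Γ₂) Δ → Proof S (Γ₁ ++ Q ∷ P ∷ Γ₂) Δ
  eR   : ∀ {Γ Δ₁ Δ₂} P Q → Proof S Γ (Δ₁ ++ P ∷ Q ∷ Δ₂) → Proof S Γ (Δ₁ ++ Q ∷ P ∷ Δ₂)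
  ¬L   : ∀ {Γ Δ} A α → Proof S Γ ((A ^ α) ∷ Δ) → Proof S (Γ ++ [ ¬′ A ^ α ]) Δ
  ¬R   : ∀ {Γ Δ} A α → Proof S (Γ ++ [ A ^ α ]) Δ → Proof S Γ ((¬′ A ^ α) ∷ Δ)
  ∧L₁  : ∀ {Γ Δ} A B α → Proof S (Γ ++ [ A ^ α ]) Δ → Proof S (Γ ++ [ (A ∧′ B) ^ α ]) Δ
  ∧L₂  : ∀ {Γ Δ} A B α → Proof S (Γ ++ [ B ^ α ]) Δ → Proof S (Γ ++ [ (A ∧′ B) ^ α ]) Δ
  ∧R   : ∀ {Γ₁ Δ₁ Γ₂ Δ₂} A B α →
         Proof S Γ₁ ((A ^ α) ∷ Δ₁) → Proof S Γ₂ ((B ^ α) ∷ Δ₂) →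
         Proof S (Γ₁ ++ Γ₂) (((A ∧′ B) ^ α) ∷ (Δ₁ ++ Δ₂))
  ∨L   : ∀ {Γ₁ Δ₁ Γ₂ Δ₂} A B α →
         Proof S (Γ₁ ++ [ A ^ α ]) Δ₁ → Proof S (Γ₂ ++ [ B ^ α ]) Δ₂ →
         Proof S (Γ₁ ++ Γ₂ ++ [ (A ∨′ B) ^ α ]) (Δ₁ ++ Δ₂)
  ∨R₁  : ∀ {Γ Δ} A B α → Proof S Γ ((A ^ α) ∷ Δ) → Proof S Γ (((A ∨′ B) ^ α) ∷ Δ)
  ∨R₂  : ∀ {Γ Δ} A B α → Proof S Γ ((B ^ α) ∷ Δ) → Proof S Γ (((A ∨′ B) ^ α) ∷ Δ)
  ⇒L   : ∀ {Γ₁ Δ₁ Γ₂ Δ₂} A B α →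
         Proof S Γ₁ ((A ^ α) ∷ Δ₁) → Proof S (Γ₂ ++ [ B ^ α ]) Δ₂ →
         Proof S (Γ₁ ++ Γ₂ ++ [ (A ⇒′ B) ^ α ]) (Δ₁ ++ Δ₂)
  ⇒R   : ∀ {Γ Δ} A B α → Proof S (Γ ++ [ A ^ α ]) ((B ^ α) ∷ Δ) →
         Proof S Γ (((A ⇒′ B) ^ α) ∷ Δ)
  □L   : ∀ {Γ Δ} A α β → Admissible S β → Witness Γ Δ α β →
         Proof S (Γ ++ [ A ^ (α ++ β) ]) Δ → Proof S (Γ ++ [ □′ A ^ α ]) Δ
  □R   : ∀ {Γ Δ} A α (x : Token) → ¬ ((α ∘ x) ∈I (Γ ++ Δ)) →
         Proof S Γ ((A ^ (α ∘ x)) ∷ Δ) → Proof S Γ ((□′ A ^ α) ∷ Δ)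
  ◇L   : ∀ {Γ Δ} A α (x : Token) → ¬ ((α ∘ x) ∈I (Γ ++ Δ)) →
         Proof S (Γ ++ [ A ^ (α ∘ x) ]) Δ → Proof S (Γ ++ [ ◇′ A ^ α ]) Δ
  ◇R   : ∀ {Γ Δ} A α β → Admissible S β → Witness Γ Δ α β →
         Proof S Γ ((A ^ (α ++ β)) ∷ Δ) → Proof S Γ ((◇′ A ^ α) ∷ Δ)

g : ∀ {S Γ Δ} → Proof S Γ Δ → ℕ
g (ax _)             = 0
g (cut P π π′ _)     = suc (degP P) ⊔ (g π ⊔ g π′)
g (wL _ π)           = g π
g (wR _ π)           = g π
g (cL _ π)           = g π
g (cR _ π)           = g π
g (eL _ _ π)         = g π
g (eR _ _ π)         = g π
g (¬L _ _ π)         = g π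
g (¬R _ _ π)         = g π
g (∧L₁ _ _ _ π)      = g π
g (∧L₂ _ _ _ π)      = g π
g (∧R _ _ _ π π′)    = g π ⊔ g π′
g (∨L _ _ _ π π′)    = g π ⊔ g π′
g (∨R₁ _ _ _ π)      = g π
g (∨R₂ _ _ _ π)      = g π
g (⇒L _ _ _ π π′)    = g π ⊔ g π′
g (⇒R _ _ _ π)       = g π
g (□L _ _ _ _ _ π)   = g π
g (□R _ _ _ _ π)     = g π
g (◇L _ _ _ _ π)     = g π
g (◇R _ _ _ _ _ π)   = g π

-- Translate both proofs into a G3-style variant of the calculus: contexts are read as
-- sets, principal formulas stay in the premises and an eigenposition rule has a premise
-- for every fresh token. There weakening is free, and positions can be renamed along any
-- map sending one-token steps to admissible steps, which instantiates eigenpositions.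
-- The cut on A is then eliminated as usual: induction on the left premise until A is
-- principal there, then on the right premise until A is principal on both sides, where
-- it is replaced by cuts on immediate subformulas (at an instantiated position in the
-- modal cases), of degree < deg A = n. Each new cut formula sits at a prefix of a
-- position of the conclusion (α by hypothesis, α ++ β by the witness of the modal
-- rule), so the side conditions of all new cuts hold.
-- Weakening, contraction and exchange translate the result back without new cuts.

module Submission where

open import Defs
open import Data.Nat using (ℕ; _≤_; suc; _⊔_; z≤n; _≟_)
open import Data.Nat.Properties using (≡ᵇ⇒≡; ≤-reflexive; 1+n≰n; ⊔-lub; m⊔n≤o⇒m≤o; m⊔n≤o⇒n≤o)
open import Data.List using (List; []; _∷_; _++_; [_]; map; concat; initLast; _∷ʳ′_)
open import Data.List.Properties
  using (++-assoc; ++-identityʳ; ++-cancelˡ; ∷ʳ-injective; ∷-injective; map-++; map-id; map-cong-local)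
open import Data.List.Extrema.Nat using (max; xs≤max)
open import Data.List.Membership.Propositional using (_∈_)
open import Data.List.Membership.Propositional.Properties
  using (∈-++⁺ˡ; ∈-++⁺ʳ; ∈-++⁻; ∈-map⁺; ∈-concat⁺′; ∈-∃++)
open import Data.List.Relation.Unary.Any using (here; there)
open import Data.List.Relation.Binary.Subset.Propositional using (_⊆_)
open import Data.List.Relation.Binary.Subset.Propositional.Properties
  using (⊆-refl; ⊆-trans; ⊆-reflexive-↭; xs⊆x∷xs; ∷⁺ʳ; ∈-∷⁺ʳ; xs⊆xs++ys; xs⊆ys++xs; ++⁺; ++⁺ʳ)
open import Data.List.Relation.Binary.Permutation.Propositional
  using (_↭_; prep; swap; ↭-sym) renaming (refl to ↭-refl; trans to ↭-trans)
open import Data.List.Relation.Binary.Permutation.Propositional.Properties using (∷↭∷ʳ; shift; ++-comm)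
import Data.List.Relation.Unary.All as All
open import Data.Product using (Σ; ∃; _×_; _,_; proj₁; proj₂)
open import Data.Sum using (_⊎_; inj₁; inj₂; [_,_]′)
open import Data.Bool using (true; false; T; _∧_)
open import Data.Bool.Properties using (T-≡; T-∧)
open import Data.Empty using (⊥; ⊥-elim)
open import Function using (_∘′_)
open import Function.Bundles using (Equivalence)
open import Relation.Binary.PropositionalEquality
  using (_≡_; refl; sym; trans; cong; cong₂; subst; subst₂; module ≡-Reasoning)
open import Relation.Nullary using (¬_; Dec; yes; no)

⪯-trans : ∀ {π ρ σ} → π ⪯ ρ → ρ ⪯ σ → π ⪯ σ
⪯-trans {π} (γ , refl) (δ , refl) = γ ++ δ , sym (++-assoc π γ δ)

∘-⋠ : ∀ α z → ¬ ((α ∘ z) ⪯ α)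
∘-⋠ []      z (γ , ())
∘-⋠ (x ∷ α) z (γ , e) = ∘-⋠ α z (γ , proj₂ (∷-injective e))

⪯-∘⁻ : ∀ {β π} t → β ⪯ (π ∘ t) → β ⪯ π ⊎ β ≡ π ∘ t
⪯-∘⁻ {β} {π} t (γ , e) with initLast γ
... | []        = inj₂ (trans (sym (++-identityʳ β)) e)
... | γ₀ ∷ʳ′ t′ = inj₁ (γ₀ , proj₁ (∷ʳ-injective (β ++ γ₀) π (trans (++-assoc β γ₀ [ t′ ]) e)))

_⪯?_ : ∀ β π → Dec (β ⪯ π)
[]      ⪯? π       = yes (π , refl)
(x ∷ β) ⪯? []      = no λ ()
(x ∷ β) ⪯? (y ∷ π) with x ≟ y | β ⪯? π
... | no x≢y   | _              = no λ (γ , e) → x≢y (proj₁ (∷-injective e))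
... | yes refl | yes (γ , refl) = yes (γ , refl)
... | yes refl | no β⋠π         = no λ (γ , e) → β⋠π (γ , proj₂ (∷-injective e))

_∉I_ : Pos → List PF → Set
π ∉I Γ = ¬ (π ∈I Γ)

fresh-token : ∀ α Γ → ∃ λ z → (α ∘ z) ∉I Γ
fresh-token α Γ = suc m , λ (P , P∈Γ , γ , e) →
  1+n≰n (All.lookup (xs≤max 0 tokens) (∈-concat⁺′ (z∈ e) (∈-map⁺ pos P∈Γ)))
  where
  tokens : List Token
  tokens = concat (map pos Γ)
  m : ℕ
  m = max 0 tokens
  z∈ : ∀ {γ π} → (α ∘ suc m) ++ γ ≡ π → suc m ∈ π
  z∈ refl = ∈-++⁺ˡ (∈-++⁺ʳ α (here refl))

admissible-[_] : ∀ {S} t → Admissible S [ t ]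
admissible-[_] {2K}  t = t , refl
admissible-[_] {2K4} t = λ ()

-- Renaming positions

-- The position maps along which G3 derivations can be transported.
StepPreserving : System → (Pos → Pos) → Set
StepPreserving S f = ∀ π t → ∃ λ β → Admissible S β × f (π ∘ t) ≡ f π ++ β

id-stepPreserving : ∀ {S} → StepPreserving S (λ π → π)
id-stepPreserving π t = [ t ] , admissible-[ t ] , refl

module _ {S f} (f-step : StepPreserving S f) where

  stepPreserving-++ : ∀ π γ → ∃ λ γ′ → f (π ++ γ) ≡ f π ++ γ′
  stepPreserving-++ π [] = [] , trans (cong f (++-identityʳ π)) (sym (++-identityʳ (f π)))
  stepPreserving-++ π (t ∷ γ) with stepPreserving-++ (π ∘ t) γ | f-step π t
  ... | γ′ , e | β , _ , e′ = β ++ γ′ ,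
    trans (cong f (sym (++-assoc π [ t ] γ))) (trans e (trans (cong (_++ γ′) e′) (++-assoc (f π) β γ′)))

  stepPreserving-⪯ : ∀ {π ρ} → π ⪯ ρ → f π ⪯ f ρ
  stepPreserving-⪯ {π} (γ , refl) with stepPreserving-++ π γ
  ... | γ′ , e = γ′ , sym e

stepPreserving-admissible : ∀ {S f} → StepPreserving S f → ∀ α β → Admissible S β →
  ∃ λ β′ → Admissible S β′ × f (α ++ β) ≡ f α ++ β′
stepPreserving-admissible {2K}  f-step α _ (x , refl) = f-step α x
stepPreserving-admissible {2K4} f-step α [] β≢[] = ⊥-elim (β≢[] refl)
stepPreserving-admissible {2K4} {f} f-step α (t ∷ γ) _
  with f-step α t | stepPreserving-++ f-step (α ∘ t) γ
... | [] , β≢[] , _ | _ = ⊥-elim (β≢[] refl)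
... | x ∷ β , _ , e | γ′ , e′ = (x ∷ β) ++ γ′ , (λ ()) ,
  trans (cong f (sym (++-assoc α [ t ] γ))) (trans e′ (trans (cong (_++ γ′) e) (++-assoc (f α) (x ∷ β) γ′)))

-- Moves the eigenposition α ∘ z, with everything below it, to f α ++ β.
graft : (Pos → Pos) → Pos → Token → Pos → Pos → Pos
graft f α z β π with (α ∘ z) ⪯? π
... | yes (γ , _) = f α ++ β ++ γ
... | no _        = f π

module _ (f : Pos → Pos) (α : Pos) (z : Token) (β : Pos) where

  graft-outside : ∀ π → ¬ ((α ∘ z) ⪯ π) → graft f α z β π ≡ f π
  graft-outside π ⋠ with (α ∘ z) ⪯? π
  ... | yes ⪯ = ⊥-elim (⋠ ⪯)
  ... | no _  = refl

  graft-inside : ∀ γ → graft f α z β ((α ∘ z) ++ γ) ≡ f α ++ β ++ γ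
  graft-inside γ with (α ∘ z) ⪯? ((α ∘ z) ++ γ)
  ... | yes (γ′ , e) = cong (λ δ → f α ++ β ++ δ) (++-cancelˡ (α ∘ z) γ′ γ e)
  ... | no ⋠         = ⊥-elim (⋠ (γ , refl))

  graft-at : graft f α z β (α ∘ z) ≡ f α ++ β
  graft-at = trans (cong (graft f α z β) (sym (++-identityʳ (α ∘ z))))
                   (trans (graft-inside []) (cong (f α ++_) (++-identityʳ β)))

  graft-stepPreserving : ∀ {S} → StepPreserving S f → Admissible S β → StepPreserving S (graft f α z β)
  graft-stepPreserving {S} f-step β-adm π t = step ((α ∘ z) ⪯? π) ((α ∘ z) ⪯? (π ∘ t))
    where
    open ≡-Reasoning
    step : Dec ((α ∘ z) ⪯ π) → Dec ((α ∘ z) ⪯ (π ∘ t)) →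
      ∃ λ β′ → Admissible S β′ × graft f α z β (π ∘ t) ≡ graft f α z β π ++ β′
    step (yes (γ , refl)) _ = [ t ] , admissible-[ t ] , (begin
      graft f α z β (((α ∘ z) ++ γ) ∘ t) ≡⟨ cong (graft f α z β) (++-assoc (α ∘ z) γ [ t ]) ⟩
      graft f α z β ((α ∘ z) ++ γ ∘ t)   ≡⟨ graft-inside (γ ∘ t) ⟩
      f α ++ β ++ γ ∘ t                  ≡⟨ cong (f α ++_) (sym (++-assoc β γ [ t ])) ⟩
      f α ++ (β ++ γ) ∘ t                ≡⟨ sym (++-assoc (f α) (β ++ γ) [ t ]) ⟩
      (f α ++ β ++ γ) ∘ t                ≡⟨ cong (_∘ t) (sym (graft-inside γ)) ⟩
      graft f α z β ((α ∘ z) ++ γ) ∘ t   ∎)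
    step (no ⋠π) (no ⋠πt) with f-step π t
    ... | β′ , β′-adm , e = β′ , β′-adm ,
      trans (graft-outside (π ∘ t) ⋠πt) (trans e (cong (_++ β′) (sym (graft-outside π ⋠π))))
    step (no ⋠π) (yes ⪯πt) with ⪯-∘⁻ t ⪯πt
    ... | inj₁ ⪯π = ⊥-elim (⋠π ⪯π)
    ... | inj₂ e with ∷ʳ-injective α π e
    ...   | refl , refl = β , β-adm ,
      trans graft-at (cong (_++ β) (sym (graft-outside α (∘-⋠ α z))))

++-⊆ : ∀ {Γ Δ Θ : List PF} → Γ ⊆ Θ → Δ ⊆ Θ → Γ ++ Δ ⊆ Θ
++-⊆ {Γ} Γ⊆Θ Δ⊆Θ P∈ with ∈-++⁻ Γ P∈
... | inj₁ P∈Γ = Γ⊆Θ P∈Γ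
... | inj₂ P∈Δ = Δ⊆Θ P∈Δ

[_]-⊆ : ∀ {P} {Γ : List PF} → P ∈ Γ → [ P ] ⊆ Γ
[ P∈ ]-⊆ = ∈-∷⁺ʳ P∈ λ ()

xs++xs⊆xs : ∀ (Γ : List PF) → Γ ++ Γ ⊆ Γ
xs++xs⊆xs Γ = ++-⊆ ⊆-refl ⊆-refl

∷ʳ-⊆ : ∀ {P} {Γ : List PF} → P ∈ Γ → Γ ++ [ P ] ⊆ Γ
∷ʳ-⊆ P∈ = ++-⊆ ⊆-refl [ P∈ ]-⊆

∷⊆∷ʳ : ∀ P (Γ : List PF) → P ∷ Γ ⊆ Γ ++ [ P ]
∷⊆∷ʳ P Γ = ⊆-reflexive-↭ (∷↭∷ʳ P Γ)

∷ʳ⊆∷ : ∀ P (Γ : List PF) → Γ ++ [ P ] ⊆ P ∷ Γ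
∷ʳ⊆∷ P Γ = ⊆-reflexive-↭ (↭-sym (∷↭∷ʳ P Γ))

swap-⊆ : ∀ {P Q} {Γ : List PF} → P ∷ Q ∷ Γ ⊆ Q ∷ P ∷ Γ
swap-⊆ = ⊆-reflexive-↭ (swap _ _ ↭-refl)

∷⊆-under : ∀ {A Q} {Γ Δ : List PF} → Γ ⊆ A ∷ Δ → Q ∷ Γ ⊆ A ∷ Q ∷ Δ
∷⊆-under Γ⊆ (here refl) = there (here refl)
∷⊆-under Γ⊆ (there P∈) with Γ⊆ P∈
... | here e   = here e
... | there P∈Δ = there (there P∈Δ)

⊆∷-under : ∀ {A Q} {Γ Δ : List PF} → Γ ⊆ A ∷ Δ → Γ ⊆ A ∷ Q ∷ Δ
⊆∷-under Γ⊆ = ⊆-trans Γ⊆ (∷⁺ʳ _ (xs⊆x∷xs _ _))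

module _ {A : Set} {F : List A → Set}
         (transpose : ∀ Θ₀ {x y Θ} → F (Θ₀ ++ x ∷ y ∷ Θ) → F (Θ₀ ++ y ∷ x ∷ Θ)) where

  ↭-closed : ∀ {Θ Θ′} → Θ ↭ Θ′ → F Θ → F Θ′
  ↭-closed = under []
    where
    regroup : ∀ Θ₀ Θ₁ {Θ} → F (Θ₀ ++ Θ₁ ++ Θ) → F ((Θ₀ ++ Θ₁) ++ Θ)
    regroup Θ₀ Θ₁ {Θ} = subst F (sym (++-assoc Θ₀ Θ₁ Θ))

    ungroup : ∀ Θ₀ Θ₁ {Θ} → F ((Θ₀ ++ Θ₁) ++ Θ) → F (Θ₀ ++ Θ₁ ++ Θ)
    ungroup Θ₀ Θ₁ {Θ} = subst F (++-assoc Θ₀ Θ₁ Θ)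

    under : ∀ Θ₀ {Θ Θ′} → Θ ↭ Θ′ → F (Θ₀ ++ Θ) → F (Θ₀ ++ Θ′)
    under Θ₀ ↭-refl        = λ u → u
    under Θ₀ (prep x p)    = ungroup Θ₀ [ x ] ∘′ under (Θ₀ ++ [ x ]) p ∘′ regroup Θ₀ [ x ]
    under Θ₀ (swap x y p)  =
      ungroup Θ₀ (y ∷ x ∷ []) ∘′ under (Θ₀ ++ y ∷ x ∷ []) p ∘′ regroup Θ₀ (y ∷ x ∷ []) ∘′ transpose Θ₀
    under Θ₀ (↭-trans p q) = under Θ₀ q ∘′ under Θ₀ p

∈I-mono : ∀ {π Γ Δ} → Γ ⊆ Δ → π ∈I Γ → π ∈I Δ
∈I-mono Γ⊆Δ (P , P∈ , π⪯) = P , Γ⊆Δ P∈ , π⪯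

∉I-anti : ∀ {π Γ Δ} → Γ ⊆ Δ → π ∉I Δ → π ∉I Γ
∉I-anti Γ⊆Δ π∉ π∈ = π∉ (∈I-mono Γ⊆Δ π∈)

Witness-mono : ∀ {Γ Δ Γ′ Δ′} α β → Γ ⊆ Γ′ → Δ ⊆ Δ′ → Witness Γ Δ α β → Witness Γ′ Δ′ α β
Witness-mono α β Γ⊆ Δ⊆ (B , η , B∈) = B , η , ++⁺ Γ⊆ Δ⊆ B∈

∈I-absorb : ∀ {A π Γ Δ} → Γ ⊆ A ∷ Δ → pos A ∈I Δ → π ∈I Γ → π ∈I Δ
∈I-absorb Γ⊆ (Q , Q∈ , A⪯Q) (P , P∈ , π⪯P) with Γ⊆ P∈
... | here refl = Q , Q∈ , ⪯-trans π⪯P A⪯Q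
... | there P∈Δ = P , P∈Δ , π⪯P

∉I-absorb : ∀ {A π Γ Δ} → Γ ⊆ A ∷ Δ → pos A ∈I Δ → π ∉I Δ → π ∉I Γ
∉I-absorb Γ⊆ A∈ π∉ π∈ = π∉ (∈I-absorb Γ⊆ A∈ π∈)

Witness-absorb : ∀ {A Γ₀ Δ₀} Γ Δ α β → Γ₀ ++ Δ₀ ⊆ A ∷ (Γ ++ Δ) → pos A ∈I (Γ ++ Δ) →
  Witness Γ₀ Δ₀ α β → Witness Γ Δ α β
Witness-absorb Γ Δ α β ⊆′ (Q , Q∈ , γ , e) (B , η , B∈) with ⊆′ B∈
... | there B∈′ = B , η , B∈′
... | here refl = fm Q , η ++ γ , subst (λ ρ → (fm Q ^ ρ) ∈ (Γ ++ Δ)) pos-Q Q∈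
  where
  pos-Q : pos Q ≡ α ++ β ++ η ++ γ
  pos-Q = trans (sym e) (trans (++-assoc α (β ++ η) γ) (cong (α ++_) (++-assoc β η γ)))

Witness-∈I : ∀ Γ Δ α β → Witness Γ Δ α β → (α ++ β) ∈I (Γ ++ Δ)
Witness-∈I Γ Δ α β (B , η , B∈) = _ , B∈ , η , ++-assoc α β η

-- A set-based calculus

-- Sequents are read as sets: an occurrence is a membership proof.
data G3 (S : System) (n : ℕ) : List PF → List PF → Set where
  Gax  : ∀ {Γ Δ P} → P ∈ Γ → P ∈ Δ → G3 S n Γ Δ
  Gcut : ∀ {Γ Δ} P → suc (degP P) ≤ n → G3 S n Γ (P ∷ Δ) → G3 S n (P ∷ Γ) Δ →
         pos P ∈I (Γ ++ Δ) → G3 S n Γ Δ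
  G¬L  : ∀ {Γ Δ} A α → (¬′ A ^ α) ∈ Γ → G3 S n Γ ((A ^ α) ∷ Δ) → G3 S n Γ Δ
  G¬R  : ∀ {Γ Δ} A α → (¬′ A ^ α) ∈ Δ → G3 S n ((A ^ α) ∷ Γ) Δ → G3 S n Γ Δ
  G∧L  : ∀ {Γ Δ} A B α → ((A ∧′ B) ^ α) ∈ Γ → G3 S n ((A ^ α) ∷ (B ^ α) ∷ Γ) Δ → G3 S n Γ Δ
  G∧R  : ∀ {Γ Δ} A B α → ((A ∧′ B) ^ α) ∈ Δ →
         G3 S n Γ ((A ^ α) ∷ Δ) → G3 S n Γ ((B ^ α) ∷ Δ) → G3 S n Γ Δ
  G∨L  : ∀ {Γ Δ} A B α → ((A ∨′ B) ^ α) ∈ Γ →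
         G3 S n ((A ^ α) ∷ Γ) Δ → G3 S n ((B ^ α) ∷ Γ) Δ → G3 S n Γ Δ
  G∨R  : ∀ {Γ Δ} A B α → ((A ∨′ B) ^ α) ∈ Δ → G3 S n Γ ((A ^ α) ∷ (B ^ α) ∷ Δ) → G3 S n Γ Δ
  G⇒L  : ∀ {Γ Δ} A B α → ((A ⇒′ B) ^ α) ∈ Γ →
         G3 S n Γ ((A ^ α) ∷ Δ) → G3 S n ((B ^ α) ∷ Γ) Δ → G3 S n Γ Δ
  G⇒R  : ∀ {Γ Δ} A B α → ((A ⇒′ B) ^ α) ∈ Δ → G3 S n ((A ^ α) ∷ Γ) ((B ^ α) ∷ Δ) → G3 S n Γ Δ
  G□L  : ∀ {Γ Δ} A α β → (□′ A ^ α) ∈ Γ → Admissible S β → Witness Γ Δ α β →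
         G3 S n ((A ^ (α ++ β)) ∷ Γ) Δ → G3 S n Γ Δ
  G□R  : ∀ {Γ Δ} A α → (□′ A ^ α) ∈ Δ →
         (∀ z → (α ∘ z) ∉I (Γ ++ Δ) → G3 S n Γ ((A ^ (α ∘ z)) ∷ Δ)) → G3 S n Γ Δ
  G◇L  : ∀ {Γ Δ} A α → (◇′ A ^ α) ∈ Γ →
         (∀ z → (α ∘ z) ∉I (Γ ++ Δ) → G3 S n ((A ^ (α ∘ z)) ∷ Γ) Δ) → G3 S n Γ Δ
  G◇R  : ∀ {Γ Δ} A α β → (◇′ A ^ α) ∈ Δ → Admissible S β → Witness Γ Δ α β →
         G3 S n Γ ((A ^ (α ++ β)) ∷ Δ) → G3 S n Γ Δ

module _ {S : System} {n : ℕ} where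

  G3-weaken : ∀ {Γ Δ Γ′ Δ′} → Γ ⊆ Γ′ → Δ ⊆ Δ′ → G3 S n Γ Δ → G3 S n Γ′ Δ′
  G3-weaken Γ⊆ Δ⊆ (Gax P∈Γ P∈Δ) = Gax (Γ⊆ P∈Γ) (Δ⊆ P∈Δ)
  G3-weaken Γ⊆ Δ⊆ (Gcut P deg< d e anchor) =
    Gcut P deg< (G3-weaken Γ⊆ (∷⁺ʳ P Δ⊆) d) (G3-weaken (∷⁺ʳ P Γ⊆) Δ⊆ e) (∈I-mono (++⁺ Γ⊆ Δ⊆) anchor)
  G3-weaken Γ⊆ Δ⊆ (G¬L A α p d)       = G¬L A α (Γ⊆ p) (G3-weaken Γ⊆ (∷⁺ʳ _ Δ⊆) d)
  G3-weaken Γ⊆ Δ⊆ (G¬R A α p d)       = G¬R A α (Δ⊆ p) (G3-weaken (∷⁺ʳ _ Γ⊆) Δ⊆ d)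
  G3-weaken Γ⊆ Δ⊆ (G∧L A B α p d)     = G∧L A B α (Γ⊆ p) (G3-weaken (∷⁺ʳ _ (∷⁺ʳ _ Γ⊆)) Δ⊆ d)
  G3-weaken Γ⊆ Δ⊆ (G∧R A B α p d e)   =
    G∧R A B α (Δ⊆ p) (G3-weaken Γ⊆ (∷⁺ʳ _ Δ⊆) d) (G3-weaken Γ⊆ (∷⁺ʳ _ Δ⊆) e)
  G3-weaken Γ⊆ Δ⊆ (G∨L A B α p d e)   =
    G∨L A B α (Γ⊆ p) (G3-weaken (∷⁺ʳ _ Γ⊆) Δ⊆ d) (G3-weaken (∷⁺ʳ _ Γ⊆) Δ⊆ e)
  G3-weaken Γ⊆ Δ⊆ (G∨R A B α p d)     = G∨R A B α (Δ⊆ p) (G3-weaken Γ⊆ (∷⁺ʳ _ (∷⁺ʳ _ Δ⊆)) d)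
  G3-weaken Γ⊆ Δ⊆ (G⇒L A B α p d e)   =
    G⇒L A B α (Γ⊆ p) (G3-weaken Γ⊆ (∷⁺ʳ _ Δ⊆) d) (G3-weaken (∷⁺ʳ _ Γ⊆) Δ⊆ e)
  G3-weaken Γ⊆ Δ⊆ (G⇒R A B α p d)     = G⇒R A B α (Δ⊆ p) (G3-weaken (∷⁺ʳ _ Γ⊆) (∷⁺ʳ _ Δ⊆) d)
  G3-weaken Γ⊆ Δ⊆ (G□L A α β p β-adm w d) =
    G□L A α β (Γ⊆ p) β-adm (Witness-mono α β Γ⊆ Δ⊆ w) (G3-weaken (∷⁺ʳ _ Γ⊆) Δ⊆ d)
  G3-weaken Γ⊆ Δ⊆ (G□R A α p E) =
    G□R A α (Δ⊆ p) λ z fresh → G3-weaken Γ⊆ (∷⁺ʳ _ Δ⊆) (E z (∉I-anti (++⁺ Γ⊆ Δ⊆) fresh))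
  G3-weaken Γ⊆ Δ⊆ (G◇L A α p E) =
    G◇L A α (Γ⊆ p) λ z fresh → G3-weaken (∷⁺ʳ _ Γ⊆) Δ⊆ (E z (∉I-anti (++⁺ Γ⊆ Δ⊆) fresh))
  G3-weaken Γ⊆ Δ⊆ (G◇R A α β p β-adm w d) =
    G◇R A α β (Δ⊆ p) β-adm (Witness-mono α β Γ⊆ Δ⊆ w) (G3-weaken Γ⊆ (∷⁺ʳ _ Δ⊆) d)

mapPos : (Pos → Pos) → List PF → List PF
mapPos f = map (λ P → fm P ^ f (pos P))

∈-mapPos : ∀ f {P Γ} → P ∈ Γ → (fm P ^ f (pos P)) ∈ mapPos f Γ
∈-mapPos f = ∈-map⁺ (λ P → fm P ^ f (pos P))

∈-mapPos-++ : ∀ f {P} Γ Δ → P ∈ (Γ ++ Δ) → (fm P ^ f (pos P)) ∈ (mapPos f Γ ++ mapPos f Δ)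
∈-mapPos-++ f {P} Γ Δ P∈ = subst ((fm P ^ f (pos P)) ∈_) (map-++ _ Γ Δ) (∈-mapPos f P∈)

mapPos-graft : ∀ f α z β Γ → (α ∘ z) ∉I Γ → mapPos (graft f α z β) Γ ≡ mapPos f Γ
mapPos-graft f α z β Γ fresh = map-cong-local (All.tabulate λ {P} P∈ →
  cong (fm P ^_) (graft-outside f α z β (pos P) λ ⪯P → fresh (P , P∈ , ⪯P)))

module _ {S : System} {n : ℕ} where

  ∈I-mapPos : ∀ {f} → StepPreserving S f → ∀ {π} Γ Δ → π ∈I (Γ ++ Δ) → f π ∈I (mapPos f Γ ++ mapPos f Δ)
  ∈I-mapPos f-step Γ Δ (P , P∈ , π⪯) = _ , ∈-mapPos-++ _ Γ Δ P∈ , stepPreserving-⪯ f-step π⪯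

  Witness-mapPos : ∀ {f} → StepPreserving S f → ∀ Γ Δ α β β′ → f (α ++ β) ≡ f α ++ β′ →
    Witness Γ Δ α β → Witness (mapPos f Γ) (mapPos f Δ) (f α) β′
  Witness-mapPos {f} f-step Γ Δ α β β′ e (B , η , B∈) with stepPreserving-++ f-step (α ++ β) η
  ... | η′ , e′ = B , η′ , subst (λ ρ → (B ^ ρ) ∈ (mapPos f Γ ++ mapPos f Δ)) image (∈-mapPos-++ f Γ Δ B∈)
    where
    image : f (α ++ β ++ η) ≡ f α ++ β′ ++ η′
    image = trans (cong f (sym (++-assoc α β η)))
                  (trans e′ (trans (cong (_++ η′) e) (++-assoc (f α) β′ η′)))

  mutual
    G3-mapPos : ∀ {f Γ Δ} → StepPreserving S f → G3 S n Γ Δ → G3 S n (mapPos f Γ) (mapPos f Δ)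
    G3-mapPos {f} f-step (Gax P∈Γ P∈Δ) = Gax (∈-mapPos f P∈Γ) (∈-mapPos f P∈Δ)
    G3-mapPos {f} {Γ} {Δ} f-step (Gcut P deg< d e anchor) =
      Gcut (fm P ^ f (pos P)) deg< (G3-mapPos f-step d) (G3-mapPos f-step e) (∈I-mapPos f-step Γ Δ anchor)
    G3-mapPos {f} f-step (G¬L A α p d) = G¬L A (f α) (∈-mapPos f p) (G3-mapPos f-step d)
    G3-mapPos {f} f-step (G¬R A α p d) = G¬R A (f α) (∈-mapPos f p) (G3-mapPos f-step d)
    G3-mapPos {f} f-step (G∧L A B α p d) = G∧L A B (f α) (∈-mapPos f p) (G3-mapPos f-step d)
    G3-mapPos {f} f-step (G∧R A B α p d e) =
      G∧R A B (f α) (∈-mapPos f p) (G3-mapPos f-step d) (G3-mapPos f-step e)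
    G3-mapPos {f} f-step (G∨L A B α p d e) =
      G∨L A B (f α) (∈-mapPos f p) (G3-mapPos f-step d) (G3-mapPos f-step e)
    G3-mapPos {f} f-step (G∨R A B α p d) = G∨R A B (f α) (∈-mapPos f p) (G3-mapPos f-step d)
    G3-mapPos {f} f-step (G⇒L A B α p d e) =
      G⇒L A B (f α) (∈-mapPos f p) (G3-mapPos f-step d) (G3-mapPos f-step e)
    G3-mapPos {f} f-step (G⇒R A B α p d) = G⇒R A B (f α) (∈-mapPos f p) (G3-mapPos f-step d)
    G3-mapPos {f} {Γ} {Δ} f-step (G□L A α β p β-adm w d) with stepPreserving-admissible f-step α β β-adm
    ... | β′ , β′-adm , e =
      G□L A (f α) β′ (∈-mapPos f p) β′-adm (Witness-mapPos f-step Γ Δ α β β′ e w)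
      (subst (λ ρ → G3 S n ((A ^ ρ) ∷ mapPos f Γ) (mapPos f Δ)) e (G3-mapPos f-step d))
    G3-mapPos {f} {Γ} {Δ} f-step (G◇R A α β p β-adm w d) with stepPreserving-admissible f-step α β β-adm
    ... | β′ , β′-adm , e =
      G◇R A (f α) β′ (∈-mapPos f p) β′-adm (Witness-mapPos f-step Γ Δ α β β′ e w)
      (subst (λ ρ → G3 S n (mapPos f Γ) ((A ^ ρ) ∷ mapPos f Δ)) e (G3-mapPos f-step d))
    G3-mapPos {f} {Γ} {Δ} f-step (G□R A α p E) = G□R A (f α) (∈-mapPos f p) λ z _ →
      let (z′ , fresh) = fresh-token α (Γ ++ Δ) in
      mapPos-eigenʳ f-step admissible-[ z ] fresh (E z′ fresh)
    G3-mapPos {f} {Γ} {Δ} f-step (G◇L A α p E) = G◇L A (f α) (∈-mapPos f p) λ z _ →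
      let (z′ , fresh) = fresh-token α (Γ ++ Δ) in
      mapPos-eigenˡ f-step admissible-[ z ] fresh (E z′ fresh)

    -- Only the active formula lies below the fresh eigenposition α ∘ z, so only it moves.
    mapPos-eigenʳ : ∀ {f Γ Δ A α z β} → StepPreserving S f → Admissible S β → (α ∘ z) ∉I (Γ ++ Δ) →
      G3 S n Γ ((A ^ (α ∘ z)) ∷ Δ) → G3 S n (mapPos f Γ) ((A ^ (f α ++ β)) ∷ mapPos f Δ)
    mapPos-eigenʳ {f} {Γ} {Δ} {A} {α} {z} {β} f-step β-adm fresh d =
      subst₂ (G3 S n) (mapPos-graft f α z β Γ (∉I-anti (xs⊆xs++ys Γ Δ) fresh))
        (cong₂ _∷_ (cong (A ^_) (graft-at f α z β))
                   (mapPos-graft f α z β Δ (∉I-anti (xs⊆ys++xs Δ Γ) fresh)))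
        (G3-mapPos (graft-stepPreserving f α z β f-step β-adm) d)

    mapPos-eigenˡ : ∀ {f Γ Δ A α z β} → StepPreserving S f → Admissible S β → (α ∘ z) ∉I (Γ ++ Δ) →
      G3 S n ((A ^ (α ∘ z)) ∷ Γ) Δ → G3 S n ((A ^ (f α ++ β)) ∷ mapPos f Γ) (mapPos f Δ)
    mapPos-eigenˡ {f} {Γ} {Δ} {A} {α} {z} {β} f-step β-adm fresh d =
      subst₂ (G3 S n)
        (cong₂ _∷_ (cong (A ^_) (graft-at f α z β))
                   (mapPos-graft f α z β Γ (∉I-anti (xs⊆xs++ys Γ Δ) fresh)))
        (mapPos-graft f α z β Δ (∉I-anti (xs⊆ys++xs Δ Γ) fresh))
        (G3-mapPos (graft-stepPreserving f α z β f-step β-adm) d)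

  instantiateʳ : ∀ {Γ Δ A α z β} → Admissible S β → (α ∘ z) ∉I (Γ ++ Δ) →
    G3 S n Γ ((A ^ (α ∘ z)) ∷ Δ) → G3 S n Γ ((A ^ (α ++ β)) ∷ Δ)
  instantiateʳ {Γ} {Δ} {A} {α} {β = β} β-adm fresh d =
    subst₂ (λ Γ′ Δ′ → G3 S n Γ′ ((A ^ (α ++ β)) ∷ Δ′)) (map-id Γ) (map-id Δ)
      (mapPos-eigenʳ id-stepPreserving β-adm fresh d)

  instantiateˡ : ∀ {Γ Δ A α z β} → Admissible S β → (α ∘ z) ∉I (Γ ++ Δ) →
    G3 S n ((A ^ (α ∘ z)) ∷ Γ) Δ → G3 S n ((A ^ (α ++ β)) ∷ Γ) Δ
  instantiateˡ {Γ} {Δ} {A} {α} {β = β} β-adm fresh d =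
    subst₂ (λ Γ′ Δ′ → G3 S n ((A ^ (α ++ β)) ∷ Γ′) Δ′) (map-id Γ) (map-id Δ)
      (mapPos-eigenˡ id-stepPreserving β-adm fresh d)

-- Cut elimination

record LeftEmbedding (A : PF) (Γ₁ Δ₁ Γ Δ : List PF) : Set where
  field
    ante₁ : Γ₁ ⊆ Γ
    succ₁ : Δ₁ ⊆ A ∷ Δ

-- Γ₂ ⊢ Δ₂ sits inside A, Γ ⊢ Δ; the anchor is the side condition of the cut on A.
record RightEmbedding (A : PF) (Γ₂ Δ₂ Γ Δ : List PF) : Set where
  field
    ante₂  : Γ₂ ⊆ A ∷ Γ
    succ₂  : Δ₂ ⊆ Δ
    anchor : pos A ∈I (Γ ++ Δ)

open LeftEmbedding
open RightEmbedding

module _ {A : PF} {Q : PF} where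

  grow₁ˡ : ∀ {Γ₁ Δ₁ Γ Δ} → LeftEmbedding A Γ₁ Δ₁ Γ Δ → LeftEmbedding A (Q ∷ Γ₁) Δ₁ (Q ∷ Γ) Δ
  grow₁ˡ e = record { ante₁ = ∷⁺ʳ Q (ante₁ e) ; succ₁ = succ₁ e }

  grow₁ʳ : ∀ {Γ₁ Δ₁ Γ Δ} → LeftEmbedding A Γ₁ Δ₁ Γ Δ → LeftEmbedding A Γ₁ (Q ∷ Δ₁) Γ (Q ∷ Δ)
  grow₁ʳ e = record { ante₁ = ante₁ e ; succ₁ = ∷⊆-under (succ₁ e) }

  grow₂ˡ : ∀ {Γ₂ Δ₂ Γ Δ} → RightEmbedding A Γ₂ Δ₂ Γ Δ → RightEmbedding A (Q ∷ Γ₂) Δ₂ (Q ∷ Γ) Δ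
  grow₂ˡ e = record { ante₂ = ∷⊆-under (ante₂ e) ; succ₂ = succ₂ e ; anchor = ∈I-mono there (anchor e) }

  grow₂ʳ : ∀ {Γ₂ Δ₂ Γ Δ} → RightEmbedding A Γ₂ Δ₂ Γ Δ → RightEmbedding A Γ₂ (Q ∷ Δ₂) Γ (Q ∷ Δ)
  grow₂ʳ {Γ = Γ} e = record
    { ante₂ = ante₂ e ; succ₂ = ∷⁺ʳ Q (succ₂ e) ; anchor = ∈I-mono (++⁺ʳ Γ there) (anchor e) }

  weaken₂ˡ : ∀ {Γ₂ Δ₂ Γ Δ} → RightEmbedding A Γ₂ Δ₂ Γ Δ → RightEmbedding A Γ₂ Δ₂ (Q ∷ Γ) Δ
  weaken₂ˡ e = record { ante₂ = ⊆∷-under (ante₂ e) ; succ₂ = succ₂ e ; anchor = ∈I-mono there (anchor e) }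

  weaken₂ʳ : ∀ {Γ₂ Δ₂ Γ Δ} → RightEmbedding A Γ₂ Δ₂ Γ Δ → RightEmbedding A Γ₂ Δ₂ Γ (Q ∷ Δ)
  weaken₂ʳ {Γ = Γ} e = record
    { ante₂ = ante₂ e ; succ₂ = there ∘′ succ₂ e ; anchor = ∈I-mono (++⁺ʳ Γ there) (anchor e) }

module _ {A : PF} {Γ Δ : List PF} where

  joint₁ : ∀ {Γ₁ Δ₁} → LeftEmbedding A Γ₁ Δ₁ Γ Δ → Γ₁ ++ Δ₁ ⊆ A ∷ (Γ ++ Δ)
  joint₁ e = ++-⊆ (there ∘′ xs⊆xs++ys Γ Δ ∘′ ante₁ e) (∷⁺ʳ A (xs⊆ys++xs Δ Γ) ∘′ succ₁ e)

  joint₂ : ∀ {Γ₂ Δ₂} → RightEmbedding A Γ₂ Δ₂ Γ Δ → Γ₂ ++ Δ₂ ⊆ A ∷ (Γ ++ Δ)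
  joint₂ e = ++-⊆ (∷⁺ʳ A (xs⊆xs++ys Γ Δ) ∘′ ante₂ e) (there ∘′ xs⊆ys++xs Δ Γ ∘′ succ₂ e)

  Witness₁ : ∀ {Γ₁ Δ₁} → LeftEmbedding A Γ₁ Δ₁ Γ Δ → pos A ∈I (Γ ++ Δ) →
    ∀ α β → Witness Γ₁ Δ₁ α β → Witness Γ Δ α β
  Witness₁ {Γ₁} {Δ₁} e A∈ α β = Witness-absorb {Γ₀ = Γ₁} {Δ₁} Γ Δ α β (joint₁ e) A∈

  Witness₂ : ∀ {Γ₂ Δ₂} → RightEmbedding A Γ₂ Δ₂ Γ Δ → ∀ α β → Witness Γ₂ Δ₂ α β → Witness Γ Δ α β
  Witness₂ {Γ₂} {Δ₂} e α β = Witness-absorb {Γ₀ = Γ₂} {Δ₂} Γ Δ α β (joint₂ e) (anchor e)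

module _ {S : System} {n : ℕ} where

  RightPremises : PF → List PF → List PF → Set
  RightPremises (prop _ ^ α)    Γ Δ = ⊥
  RightPremises (¬′ B ^ α)      Γ Δ = G3 S n ((B ^ α) ∷ Γ) Δ
  RightPremises ((B ∧′ C) ^ α)  Γ Δ = G3 S n Γ ((B ^ α) ∷ Δ) × G3 S n Γ ((C ^ α) ∷ Δ)
  RightPremises ((B ∨′ C) ^ α)  Γ Δ = G3 S n Γ ((B ^ α) ∷ (C ^ α) ∷ Δ)
  RightPremises ((B ⇒′ C) ^ α)  Γ Δ = G3 S n ((B ^ α) ∷ Γ) ((C ^ α) ∷ Δ)
  RightPremises (□′ B ^ α)      Γ Δ = ∀ z → (α ∘ z) ∉I (Γ ++ Δ) → G3 S n Γ ((B ^ (α ∘ z)) ∷ Δ)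
  RightPremises (◇′ B ^ α)      Γ Δ =
    ∃ λ β → Admissible S β × Witness Γ Δ α β × G3 S n Γ ((B ^ (α ++ β)) ∷ Δ)

  rightRule : ∀ A {Γ Δ} → A ∈ Δ → RightPremises A Γ Δ → G3 S n Γ Δ
  rightRule (prop _ ^ α)   A∈ ()
  rightRule (¬′ B ^ α)     A∈ d                     = G¬R B α A∈ d
  rightRule ((B ∧′ C) ^ α) A∈ (d , e)               = G∧R B C α A∈ d e
  rightRule ((B ∨′ C) ^ α) A∈ d                     = G∨R B C α A∈ d
  rightRule ((B ⇒′ C) ^ α) A∈ d                     = G⇒R B C α A∈ d
  rightRule (□′ B ^ α)     A∈ E                     = G□R B α A∈ E
  rightRule (◇′ B ^ α)     A∈ (β , β-adm , w , d)   = G◇R B α β A∈ β-adm w d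

  RightPremises-weaken : ∀ A {Γ Δ Γ′ Δ′} → Γ ⊆ Γ′ → Δ ⊆ Δ′ → RightPremises A Γ Δ → RightPremises A Γ′ Δ′
  RightPremises-weaken (prop _ ^ α)   Γ⊆ Δ⊆ ()
  RightPremises-weaken (¬′ B ^ α)     Γ⊆ Δ⊆ d       = G3-weaken (∷⁺ʳ _ Γ⊆) Δ⊆ d
  RightPremises-weaken ((B ∧′ C) ^ α) Γ⊆ Δ⊆ (d , e) =
    G3-weaken Γ⊆ (∷⁺ʳ _ Δ⊆) d , G3-weaken Γ⊆ (∷⁺ʳ _ Δ⊆) e
  RightPremises-weaken ((B ∨′ C) ^ α) Γ⊆ Δ⊆ d       = G3-weaken Γ⊆ (∷⁺ʳ _ (∷⁺ʳ _ Δ⊆)) d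
  RightPremises-weaken ((B ⇒′ C) ^ α) Γ⊆ Δ⊆ d       = G3-weaken (∷⁺ʳ _ Γ⊆) (∷⁺ʳ _ Δ⊆) d
  RightPremises-weaken (□′ B ^ α)     Γ⊆ Δ⊆ E       =
    λ z fresh → G3-weaken Γ⊆ (∷⁺ʳ _ Δ⊆) (E z (∉I-anti (++⁺ Γ⊆ Δ⊆) fresh))
  RightPremises-weaken (◇′ B ^ α)     Γ⊆ Δ⊆ (β , β-adm , w , d) =
    β , β-adm , Witness-mono α β Γ⊆ Δ⊆ w , G3-weaken Γ⊆ (∷⁺ʳ _ Δ⊆) d

  premises-∷ˡ : ∀ A {Q Γ Δ} → RightPremises A Γ Δ → RightPremises A (Q ∷ Γ) Δ
  premises-∷ˡ A = RightPremises-weaken A (xs⊆x∷xs _ _) ⊆-refl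

  premises-∷ʳ : ∀ A {Q Γ Δ} → RightPremises A Γ Δ → RightPremises A Γ (Q ∷ Δ)
  premises-∷ʳ A = RightPremises-weaken A ⊆-refl (xs⊆x∷xs _ _)

  ⊔-boundˡ : ∀ a b → suc (a ⊔ b) ≤ n → suc a ≤ n
  ⊔-boundˡ a b = m⊔n≤o⇒m≤o (suc a) (suc b)

  ⊔-boundʳ : ∀ a b → suc (a ⊔ b) ≤ n → suc b ≤ n
  ⊔-boundʳ a b = m⊔n≤o⇒n≤o (suc a) (suc b)

  principal-∧ : ∀ {B C α Γ Δ} → suc (deg B ⊔ deg C) ≤ n → α ∈I (Γ ++ Δ) →
    G3 S n Γ ((B ^ α) ∷ Δ) → G3 S n Γ ((C ^ α) ∷ Δ) → G3 S n ((B ^ α) ∷ (C ^ α) ∷ Γ) Δ → G3 S n Γ Δ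
  principal-∧ {B} {C} {α} deg≤ anchor dB dC d =
    Gcut (B ^ α) (⊔-boundˡ (deg B) (deg C) deg≤) dB
      (Gcut (C ^ α) (⊔-boundʳ (deg B) (deg C) deg≤)
        (G3-weaken (xs⊆x∷xs _ _) ⊆-refl dC) (G3-weaken swap-⊆ ⊆-refl d) (∈I-mono there anchor))
      anchor

  principal-∨ : ∀ {B C α Γ Δ} → suc (deg B ⊔ deg C) ≤ n → α ∈I (Γ ++ Δ) →
    G3 S n Γ ((B ^ α) ∷ (C ^ α) ∷ Δ) → G3 S n ((B ^ α) ∷ Γ) Δ → G3 S n ((C ^ α) ∷ Γ) Δ → G3 S n Γ Δ
  principal-∨ {B} {C} {α} {Γ} deg≤ anchor d dB dC =
    Gcut (B ^ α) (⊔-boundˡ (deg B) (deg C) deg≤)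
      (Gcut (C ^ α) (⊔-boundʳ (deg B) (deg C) deg≤)
        (G3-weaken ⊆-refl swap-⊆ d) (G3-weaken ⊆-refl (xs⊆x∷xs _ _) dC) (∈I-mono (++⁺ʳ Γ there) anchor))
      dB anchor

  principal-⇒ : ∀ {B C α Γ Δ} → suc (deg B ⊔ deg C) ≤ n → α ∈I (Γ ++ Δ) →
    G3 S n ((B ^ α) ∷ Γ) ((C ^ α) ∷ Δ) → G3 S n Γ ((B ^ α) ∷ Δ) → G3 S n ((C ^ α) ∷ Γ) Δ → G3 S n Γ Δ
  principal-⇒ {B} {C} {α} deg≤ anchor d dB dC =
    Gcut (B ^ α) (⊔-boundˡ (deg B) (deg C) deg≤) dB
      (Gcut (C ^ α) (⊔-boundʳ (deg B) (deg C) deg≤)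
        d (G3-weaken (∷⁺ʳ _ (xs⊆x∷xs _ _)) ⊆-refl dC) (∈I-mono there anchor))
      anchor

  -- The eigenposition of the □-premise is instantiated by the witnessed α ++ β.
  principal-□ : ∀ {B α β Γ Δ} → suc (deg B) ≤ n → Admissible S β → Witness Γ Δ α β →
    (∀ z → (α ∘ z) ∉I (Γ ++ Δ) → G3 S n Γ ((B ^ (α ∘ z)) ∷ Δ)) →
    G3 S n ((B ^ (α ++ β)) ∷ Γ) Δ → G3 S n Γ Δ
  principal-□ {B} {α} {β} {Γ} {Δ} deg≤ β-adm w E d =
    let (z , fresh) = fresh-token α (Γ ++ Δ) in
    Gcut (B ^ (α ++ β)) deg≤ (instantiateʳ β-adm fresh (E z fresh)) d (Witness-∈I Γ Δ α β w)

  principal-◇ : ∀ {B α β Γ Δ} → suc (deg B) ≤ n → Admissible S β → Witness Γ Δ α β →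
    G3 S n Γ ((B ^ (α ++ β)) ∷ Δ) →
    (∀ z → (α ∘ z) ∉I (Γ ++ Δ) → G3 S n ((B ^ (α ∘ z)) ∷ Γ) Δ) → G3 S n Γ Δ
  principal-◇ {B} {α} {β} {Γ} {Δ} deg≤ β-adm w d E =
    let (z , fresh) = fresh-token α (Γ ++ Δ) in
    Gcut (B ^ (α ++ β)) deg≤ d (instantiateˡ β-adm fresh (E z fresh)) (Witness-∈I Γ Δ α β w)

  cut-principal : ∀ {A Γ₂ Δ₂ Γ Δ} → deg (fm A) ≤ n → RightPremises A Γ Δ → G3 S n Γ₂ Δ₂ →
    RightEmbedding A Γ₂ Δ₂ Γ Δ → G3 S n Γ Δ
  cut-principal {A} deg≤ i (Gax p q) e with ante₂ e p
  ... | here refl = rightRule A (succ₂ e q) i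
  ... | there p′  = Gax p′ (succ₂ e q)
  cut-principal {A} deg≤ i (Gcut P deg< d₁ d₂ anchor′) e =
    Gcut P deg< (cut-principal deg≤ (premises-∷ʳ A i) d₁ (grow₂ʳ e))
                (cut-principal deg≤ (premises-∷ˡ A i) d₂ (grow₂ˡ e))
                (∈I-absorb (joint₂ e) (anchor e) anchor′)
  cut-principal {A} deg≤ i (G¬L B α p d) e
    with ante₂ e p | cut-principal deg≤ (premises-∷ʳ A i) d (grow₂ʳ e)
  ... | here refl | d′ = Gcut (B ^ α) deg≤ d′ i (anchor e)
  ... | there p′  | d′ = G¬L B α p′ d′
  cut-principal {A} deg≤ i (G¬R B α p d) e =
    G¬R B α (succ₂ e p) (cut-principal deg≤ (premises-∷ˡ A i) d (grow₂ˡ e))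
  cut-principal {A} deg≤ i (G∧L B C α p d) e
    with ante₂ e p | cut-principal deg≤ (premises-∷ˡ A (premises-∷ˡ A i)) d (grow₂ˡ (grow₂ˡ e))
  ... | here refl | d′ = principal-∧ deg≤ (anchor e) (proj₁ i) (proj₂ i) d′
  ... | there p′  | d′ = G∧L B C α p′ d′
  cut-principal {A} deg≤ i (G∧R B C α p d₁ d₂) e =
    G∧R B C α (succ₂ e p) (cut-principal deg≤ (premises-∷ʳ A i) d₁ (grow₂ʳ e))
                          (cut-principal deg≤ (premises-∷ʳ A i) d₂ (grow₂ʳ e))
  cut-principal {A} deg≤ i (G∨L B C α p d₁ d₂) e
    with ante₂ e p | cut-principal deg≤ (premises-∷ˡ A i) d₁ (grow₂ˡ e)
                   | cut-principal deg≤ (premises-∷ˡ A i) d₂ (grow₂ˡ e)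
  ... | here refl | d₁′ | d₂′ = principal-∨ deg≤ (anchor e) i d₁′ d₂′
  ... | there p′  | d₁′ | d₂′ = G∨L B C α p′ d₁′ d₂′
  cut-principal {A} deg≤ i (G∨R B C α p d) e =
    G∨R B C α (succ₂ e p) (cut-principal deg≤ (premises-∷ʳ A (premises-∷ʳ A i)) d (grow₂ʳ (grow₂ʳ e)))
  cut-principal {A} deg≤ i (G⇒L B C α p d₁ d₂) e
    with ante₂ e p | cut-principal deg≤ (premises-∷ʳ A i) d₁ (grow₂ʳ e)
                   | cut-principal deg≤ (premises-∷ˡ A i) d₂ (grow₂ˡ e)
  ... | here refl | d₁′ | d₂′ = principal-⇒ deg≤ (anchor e) i d₁′ d₂′
  ... | there p′  | d₁′ | d₂′ = G⇒L B C α p′ d₁′ d₂′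
  cut-principal {A} deg≤ i (G⇒R B C α p d) e =
    G⇒R B C α (succ₂ e p) (cut-principal deg≤ (premises-∷ˡ A (premises-∷ʳ A i)) d (grow₂ˡ (grow₂ʳ e)))
  cut-principal {A} deg≤ i (G□L B α β p β-adm w d) e
    with ante₂ e p | cut-principal deg≤ (premises-∷ˡ A i) d (grow₂ˡ e)
  ... | here refl | d′ = principal-□ deg≤ β-adm (Witness₂ e α β w) i d′
  ... | there p′  | d′ = G□L B α β p′ β-adm (Witness₂ e α β w) d′
  cut-principal {A} deg≤ i (G□R B α p E) e = G□R B α (succ₂ e p) λ z fresh →
    cut-principal deg≤ (premises-∷ʳ A i) (E z (∉I-absorb (joint₂ e) (anchor e) fresh)) (grow₂ʳ e)
  cut-principal {A} deg≤ i (G◇L B α p E) e with ante₂ e p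
  ... | here refl = let (β , β-adm , w , d) = i in principal-◇ deg≤ β-adm w d E′
    where E′ = λ z fresh → cut-principal deg≤ (premises-∷ˡ A i)
                             (E z (∉I-absorb (joint₂ e) (anchor e) fresh)) (grow₂ˡ e)
  ... | there p′  = G◇L B α p′ λ z fresh →
    cut-principal deg≤ (premises-∷ˡ A i) (E z (∉I-absorb (joint₂ e) (anchor e) fresh)) (grow₂ˡ e)
  cut-principal {A} deg≤ i (G◇R B α β p β-adm w d) e =
    G◇R B α β (succ₂ e p) β-adm (Witness₂ e α β w) (cut-principal deg≤ (premises-∷ʳ A i) d (grow₂ʳ e))

  cut-admissible : ∀ {A Γ₁ Δ₁ Γ₂ Δ₂ Γ Δ} → deg (fm A) ≤ n → G3 S n Γ₁ Δ₁ → G3 S n Γ₂ Δ₂ →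
    LeftEmbedding A Γ₁ Δ₁ Γ Δ → RightEmbedding A Γ₂ Δ₂ Γ Δ → G3 S n Γ Δ
  cut-admissible deg≤ (Gax p q) D₂ e₁ e₂ with succ₁ e₁ q
  ... | here refl = G3-weaken (⊆-trans (ante₂ e₂) (∈-∷⁺ʳ (ante₁ e₁ p) ⊆-refl)) (succ₂ e₂) D₂
  ... | there q′  = Gax (ante₁ e₁ p) q′
  cut-admissible deg≤ (Gcut P deg< d₁ d₂ anchor′) D₂ e₁ e₂ =
    Gcut P deg< (cut-admissible deg≤ d₁ D₂ (grow₁ʳ e₁) (weaken₂ʳ e₂))
                (cut-admissible deg≤ d₂ D₂ (grow₁ˡ e₁) (weaken₂ˡ e₂))
                (∈I-absorb (joint₁ e₁) (anchor e₂) anchor′)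
  cut-admissible deg≤ (G¬L B α p d) D₂ e₁ e₂ =
    G¬L B α (ante₁ e₁ p) (cut-admissible deg≤ d D₂ (grow₁ʳ e₁) (weaken₂ʳ e₂))
  cut-admissible deg≤ (G¬R B α p d) D₂ e₁ e₂
    with succ₁ e₁ p | cut-admissible deg≤ d D₂ (grow₁ˡ e₁) (weaken₂ˡ e₂)
  ... | here refl | d′ = cut-principal deg≤ d′ D₂ e₂
  ... | there p′  | d′ = G¬R B α p′ d′
  cut-admissible deg≤ (G∧L B C α p d) D₂ e₁ e₂ =
    G∧L B C α (ante₁ e₁ p) (cut-admissible deg≤ d D₂ (grow₁ˡ (grow₁ˡ e₁)) (weaken₂ˡ (weaken₂ˡ e₂)))
  cut-admissible deg≤ (G∧R B C α p d₁ d₂) D₂ e₁ e₂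
    with succ₁ e₁ p | cut-admissible deg≤ d₁ D₂ (grow₁ʳ e₁) (weaken₂ʳ e₂)
                    | cut-admissible deg≤ d₂ D₂ (grow₁ʳ e₁) (weaken₂ʳ e₂)
  ... | here refl | d₁′ | d₂′ = cut-principal deg≤ (d₁′ , d₂′) D₂ e₂
  ... | there p′  | d₁′ | d₂′ = G∧R B C α p′ d₁′ d₂′
  cut-admissible deg≤ (G∨L B C α p d₁ d₂) D₂ e₁ e₂ =
    G∨L B C α (ante₁ e₁ p) (cut-admissible deg≤ d₁ D₂ (grow₁ˡ e₁) (weaken₂ˡ e₂))
                           (cut-admissible deg≤ d₂ D₂ (grow₁ˡ e₁) (weaken₂ˡ e₂))
  cut-admissible deg≤ (G∨R B C α p d) D₂ e₁ e₂
    with succ₁ e₁ p | cut-admissible deg≤ d D₂ (grow₁ʳ (grow₁ʳ e₁)) (weaken₂ʳ (weaken₂ʳ e₂))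
  ... | here refl | d′ = cut-principal deg≤ d′ D₂ e₂
  ... | there p′  | d′ = G∨R B C α p′ d′
  cut-admissible deg≤ (G⇒L B C α p d₁ d₂) D₂ e₁ e₂ =
    G⇒L B C α (ante₁ e₁ p) (cut-admissible deg≤ d₁ D₂ (grow₁ʳ e₁) (weaken₂ʳ e₂))
                           (cut-admissible deg≤ d₂ D₂ (grow₁ˡ e₁) (weaken₂ˡ e₂))
  cut-admissible deg≤ (G⇒R B C α p d) D₂ e₁ e₂
    with succ₁ e₁ p | cut-admissible deg≤ d D₂ (grow₁ˡ (grow₁ʳ e₁)) (weaken₂ˡ (weaken₂ʳ e₂))
  ... | here refl | d′ = cut-principal deg≤ d′ D₂ e₂
  ... | there p′  | d′ = G⇒R B C α p′ d′
  cut-admissible deg≤ (G□L B α β p β-adm w d) D₂ e₁ e₂ =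
    G□L B α β (ante₁ e₁ p) β-adm (Witness₁ e₁ (anchor e₂) α β w)
      (cut-admissible deg≤ d D₂ (grow₁ˡ e₁) (weaken₂ˡ e₂))
  cut-admissible deg≤ (G□R B α p E) D₂ e₁ e₂ with succ₁ e₁ p
  ... | here refl = cut-principal deg≤ E′ D₂ e₂
    where E′ = λ z fresh → cut-admissible deg≤ (E z (∉I-absorb (joint₁ e₁) (anchor e₂) fresh)) D₂
                             (grow₁ʳ e₁) (weaken₂ʳ e₂)
  ... | there p′  = G□R B α p′ λ z fresh →
    cut-admissible deg≤ (E z (∉I-absorb (joint₁ e₁) (anchor e₂) fresh)) D₂ (grow₁ʳ e₁) (weaken₂ʳ e₂)
  cut-admissible deg≤ (G◇L B α p E) D₂ e₁ e₂ = G◇L B α (ante₁ e₁ p) λ z fresh →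
    cut-admissible deg≤ (E z (∉I-absorb (joint₁ e₁) (anchor e₂) fresh)) D₂ (grow₁ˡ e₁) (weaken₂ˡ e₂)
  cut-admissible deg≤ (G◇R B α β p β-adm w d) D₂ e₁ e₂
    with succ₁ e₁ p | cut-admissible deg≤ d D₂ (grow₁ʳ e₁) (weaken₂ʳ e₂)
  ... | here refl | d′ = cut-principal deg≤ (β , β-adm , Witness₁ e₁ (anchor e₂) α β w , d′) D₂ e₂
  ... | there p′  | d′ = G◇R B α β p′ β-adm (Witness₁ e₁ (anchor e₂) α β w) d′

-- Structural rules and translations

BoundedProof : System → ℕ → List PF → List PF → Set
BoundedProof S n Γ Δ = Σ (Proof S Γ Δ) (λ Π → g Π ≤ n)

module _ {S : System} {n : ℕ} where

  exchangeˡ : ∀ {Γ Γ′ Δ} → Γ ↭ Γ′ → BoundedProof S n Γ Δ → BoundedProof S n Γ′ Δ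
  exchangeˡ {Δ = Δ} = ↭-closed {F = λ Γ → BoundedProof S n Γ Δ} λ Γ₀ (Π , b) → eL {Γ₁ = Γ₀} _ _ Π , b

  exchangeʳ : ∀ {Γ Δ Δ′} → Δ ↭ Δ′ → BoundedProof S n Γ Δ → BoundedProof S n Γ Δ′
  exchangeʳ {Γ} = ↭-closed {F = BoundedProof S n Γ} λ Δ₀ (Π , b) → eR {Δ₁ = Δ₀} _ _ Π , b

  contractˡ : ∀ {P Γ Δ} → P ∈ Γ → BoundedProof S n (P ∷ Γ) Δ → BoundedProof S n Γ Δ
  contractˡ {P} P∈ Π with ∈-∃++ P∈
  ... | Γ₁ , Γ₂ , refl =
    let (Π′ , b) = exchangeˡ (↭-trans (prep P (shift P Γ₁ Γ₂)) (++-comm (P ∷ P ∷ []) (Γ₁ ++ Γ₂))) Π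
    in exchangeˡ (↭-trans (↭-sym (∷↭∷ʳ P (Γ₁ ++ Γ₂))) (↭-sym (shift P Γ₁ Γ₂))) (cL P Π′ , b)

  contractʳ : ∀ {P Γ Δ} → P ∈ Δ → BoundedProof S n Γ (P ∷ Δ) → BoundedProof S n Γ Δ
  contractʳ {P} P∈ Π with ∈-∃++ P∈
  ... | Δ₁ , Δ₂ , refl =
    let (Π′ , b) = exchangeʳ (prep P (shift P Δ₁ Δ₂)) Π
    in exchangeʳ (↭-sym (shift P Δ₁ Δ₂)) (cR P Π′ , b)

  weakenˡ : ∀ {Γ Δ} Γ′ → BoundedProof S n Γ Δ → BoundedProof S n (Γ ++ Γ′) Δ
  weakenˡ {Γ} {Δ} []       Π       = subst (λ Θ → BoundedProof S n Θ Δ) (sym (++-identityʳ Γ)) Π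
  weakenˡ {Γ} {Δ} (P ∷ Γ′) (Π , b) =
    subst (λ Θ → BoundedProof S n Θ Δ) (++-assoc Γ [ P ] Γ′) (weakenˡ Γ′ (wL P Π , b))

  weakenʳ : ∀ {Γ Δ} Δ′ → BoundedProof S n Γ Δ → BoundedProof S n Γ (Δ′ ++ Δ)
  weakenʳ []       Π = Π
  weakenʳ (P ∷ Δ′) Π = let (Π′ , b) = weakenʳ Δ′ Π in wR P Π′ , b

  absorbˡ : ∀ {Γ′ Δ} Γ → Γ ⊆ Γ′ → BoundedProof S n (Γ ++ Γ′) Δ → BoundedProof S n Γ′ Δ
  absorbˡ []      _  Π = Π
  absorbˡ (P ∷ Γ) Γ⊆ Π = absorbˡ Γ (Γ⊆ ∘′ there) (contractˡ (∈-++⁺ʳ Γ (Γ⊆ (here refl))) Π)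

  absorbʳ : ∀ {Γ Δ′} Δ → Δ ⊆ Δ′ → BoundedProof S n Γ (Δ ++ Δ′) → BoundedProof S n Γ Δ′
  absorbʳ []      _  Π = Π
  absorbʳ (P ∷ Δ) Δ⊆ Π = absorbʳ Δ (Δ⊆ ∘′ there) (contractʳ (∈-++⁺ʳ Δ (Δ⊆ (here refl))) Π)

  restructure : ∀ {Γ Δ Γ′ Δ′} → Γ ⊆ Γ′ → Δ ⊆ Δ′ → BoundedProof S n Γ Δ → BoundedProof S n Γ′ Δ′
  restructure {Γ} {Δ} {Γ′} {Δ′} Γ⊆ Δ⊆ =
    absorbʳ Δ Δ⊆ ∘′ exchangeʳ (++-comm Δ′ Δ) ∘′ weakenʳ Δ′ ∘′ absorbˡ Γ Γ⊆ ∘′ weakenˡ Γ′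

  fromProof : ∀ {Γ Δ} (Π : Proof S Γ Δ) → g Π ≤ n → G3 S n Γ Δ
  fromProof (ax P) _ = Gax (here refl) (here refl)
  fromProof (cut {Γ₁} {Δ₁} {Γ₂} {Δ₂} P Π Π′ side) b =
    Gcut P (m⊔n≤o⇒m≤o (suc (degP P)) (g Π ⊔ g Π′) b)
      (G3-weaken (xs⊆xs++ys Γ₁ Γ₂) (∷⁺ʳ P (xs⊆xs++ys Δ₁ Δ₂))
        (fromProof Π (m⊔n≤o⇒m≤o (g Π) (g Π′) b′)))
      (G3-weaken (++-⊆ (there ∘′ xs⊆ys++xs Γ₂ Γ₁) [ here refl ]-⊆) (xs⊆ys++xs Δ₂ Δ₁)
        (fromProof Π′ (m⊔n≤o⇒n≤o (g Π) (g Π′) b′)))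
      (cut-anchor side)
    where
    b′ = m⊔n≤o⇒n≤o (suc (degP P)) (g Π ⊔ g Π′) b
    cut-anchor : pos P ∈I (Γ₁ ++ Δ₁) ⊎ pos P ∈I (Γ₂ ++ Δ₂) → pos P ∈I ((Γ₁ ++ Γ₂) ++ (Δ₁ ++ Δ₂))
    cut-anchor (inj₁ P∈) = ∈I-mono (++⁺ (xs⊆xs++ys Γ₁ Γ₂) (xs⊆xs++ys Δ₁ Δ₂)) P∈
    cut-anchor (inj₂ P∈) = ∈I-mono (++⁺ (xs⊆ys++xs Γ₂ Γ₁) (xs⊆ys++xs Δ₂ Δ₁)) P∈
  fromProof (wL {Γ} P Π) b = G3-weaken (xs⊆xs++ys Γ [ P ]) ⊆-refl (fromProof Π b)
  fromProof (wR P Π) b = G3-weaken ⊆-refl (xs⊆x∷xs _ P) (fromProof Π b)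
  fromProof (cL {Γ} P Π) b = G3-weaken (++⁺ʳ Γ (∈-∷⁺ʳ (here refl) ⊆-refl)) ⊆-refl (fromProof Π b)
  fromProof (cR P Π) b = G3-weaken ⊆-refl (∈-∷⁺ʳ (here refl) ⊆-refl) (fromProof Π b)
  fromProof (eL {Γ₁} P Q Π) b = G3-weaken (++⁺ʳ Γ₁ swap-⊆) ⊆-refl (fromProof Π b)
  fromProof (eR {Δ₁ = Δ₁} P Q Π) b = G3-weaken ⊆-refl (++⁺ʳ Δ₁ swap-⊆) (fromProof Π b)
  fromProof (¬L {Γ} A α Π) b =
    G¬L A α (∈-++⁺ʳ Γ (here refl)) (G3-weaken (xs⊆xs++ys Γ _) ⊆-refl (fromProof Π b))
  fromProof (¬R {Γ} A α Π) b =
    G¬R A α (here refl) (G3-weaken (∷ʳ⊆∷ _ Γ) (xs⊆x∷xs _ _) (fromProof Π b))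
  fromProof (∧L₁ {Γ} A B α Π) b =
    G∧L A B α (∈-++⁺ʳ Γ (here refl))
      (G3-weaken (++-⊆ (there ∘′ there ∘′ xs⊆xs++ys Γ _) [ here refl ]-⊆) ⊆-refl (fromProof Π b))
  fromProof (∧L₂ {Γ} A B α Π) b =
    G∧L A B α (∈-++⁺ʳ Γ (here refl))
      (G3-weaken (++-⊆ (there ∘′ there ∘′ xs⊆xs++ys Γ _) [ there (here refl) ]-⊆) ⊆-refl (fromProof Π b))
  fromProof (∧R {Γ₁} {Δ₁} {Γ₂} {Δ₂} A B α Π Π′) b =
    G∧R A B α (here refl)
      (G3-weaken (xs⊆xs++ys Γ₁ Γ₂) (∷⁺ʳ _ (there ∘′ xs⊆xs++ys Δ₁ Δ₂))
        (fromProof Π (m⊔n≤o⇒m≤o (g Π) (g Π′) b)))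
      (G3-weaken (xs⊆ys++xs Γ₂ Γ₁) (∷⁺ʳ _ (there ∘′ xs⊆ys++xs Δ₂ Δ₁))
        (fromProof Π′ (m⊔n≤o⇒n≤o (g Π) (g Π′) b)))
  fromProof (∨L {Γ₁} {Δ₁} {Γ₂} {Δ₂} A B α Π Π′) b =
    G∨L A B α (∈-++⁺ʳ Γ₁ (∈-++⁺ʳ Γ₂ (here refl)))
      (G3-weaken (++-⊆ (there ∘′ xs⊆xs++ys Γ₁ _) [ here refl ]-⊆) (xs⊆xs++ys Δ₁ Δ₂)
        (fromProof Π (m⊔n≤o⇒m≤o (g Π) (g Π′) b)))
      (G3-weaken (++-⊆ (there ∘′ xs⊆ys++xs _ Γ₁ ∘′ xs⊆xs++ys Γ₂ _) [ here refl ]-⊆) (xs⊆ys++xs Δ₂ Δ₁)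
        (fromProof Π′ (m⊔n≤o⇒n≤o (g Π) (g Π′) b)))
  fromProof (∨R₁ A B α Π) b =
    G∨R A B α (here refl) (G3-weaken ⊆-refl (∷⁺ʳ _ (there ∘′ there)) (fromProof Π b))
  fromProof (∨R₂ A B α Π) b =
    G∨R A B α (here refl)
      (G3-weaken ⊆-refl (∈-∷⁺ʳ (there (here refl)) (there ∘′ there ∘′ there)) (fromProof Π b))
  fromProof (⇒L {Γ₁} {Δ₁} {Γ₂} {Δ₂} A B α Π Π′) b =
    G⇒L A B α (∈-++⁺ʳ Γ₁ (∈-++⁺ʳ Γ₂ (here refl)))
      (G3-weaken (xs⊆xs++ys Γ₁ _) (∷⁺ʳ _ (xs⊆xs++ys Δ₁ Δ₂))
        (fromProof Π (m⊔n≤o⇒m≤o (g Π) (g Π′) b)))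
      (G3-weaken (++-⊆ (there ∘′ xs⊆ys++xs _ Γ₁ ∘′ xs⊆xs++ys Γ₂ _) [ here refl ]-⊆) (xs⊆ys++xs Δ₂ Δ₁)
        (fromProof Π′ (m⊔n≤o⇒n≤o (g Π) (g Π′) b)))
  fromProof (⇒R {Γ} A B α Π) b =
    G⇒R A B α (here refl) (G3-weaken (∷ʳ⊆∷ _ Γ) (∷⁺ʳ _ there) (fromProof Π b))
  fromProof (□L {Γ} A α β β-adm w Π) b =
    G□L A α β (∈-++⁺ʳ Γ (here refl)) β-adm (Witness-mono α β (xs⊆xs++ys Γ _) ⊆-refl w)
      (G3-weaken (++-⊆ (there ∘′ xs⊆xs++ys Γ _) [ here refl ]-⊆) ⊆-refl (fromProof Π b))
  fromProof (◇R A α β β-adm w Π) b =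
    G◇R A α β (here refl) β-adm (Witness-mono α β ⊆-refl there w)
      (G3-weaken ⊆-refl (∷⁺ʳ _ there) (fromProof Π b))
  fromProof (□R A α x fresh Π) b = G□R A α (here refl) λ z _ →
    G3-weaken ⊆-refl (∷⁺ʳ _ there) (instantiateʳ admissible-[ z ] fresh (fromProof Π b))
  fromProof (◇L {Γ} A α x fresh Π) b = G◇L A α (∈-++⁺ʳ Γ (here refl)) λ z _ →
    G3-weaken (∷⁺ʳ _ (xs⊆xs++ys Γ _)) ⊆-refl
      (instantiateˡ admissible-[ z ] fresh (G3-weaken (∷ʳ⊆∷ _ Γ) ⊆-refl (fromProof Π b)))

  toProof : ∀ {Γ Δ} → G3 S n Γ Δ → BoundedProof S n Γ Δ
  toProof (Gax {P = P} P∈Γ P∈Δ) = restructure [ P∈Γ ]-⊆ [ P∈Δ ]-⊆ (ax P , z≤n)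
  toProof {Γ} (Gcut P deg< d e anchor) =
    let (Π , b) = toProof d
        (Π′ , b′) = restructure (∷⊆∷ʳ P Γ) ⊆-refl (toProof e)
    in restructure (xs++xs⊆xs _) (xs++xs⊆xs _) (cut P Π Π′ (inj₁ anchor) , ⊔-lub deg< (⊔-lub b b′))
  toProof (G¬L A α p d) =
    let (Π , b) = toProof d in restructure (∷ʳ-⊆ p) ⊆-refl (¬L A α Π , b)
  toProof {Γ} (G¬R A α p d) =
    let (Π , b) = restructure (∷⊆∷ʳ _ Γ) ⊆-refl (toProof d)
    in restructure ⊆-refl (∈-∷⁺ʳ p ⊆-refl) (¬R A α Π , b)
  toProof {Γ} (G∧L A B α p d) =
    let (Π , b) = restructure (⊆-trans (∷⁺ʳ _ (∷⊆∷ʳ _ Γ)) (∷⊆∷ʳ _ _)) ⊆-refl (toProof d)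
        (Π′ , b′) = restructure (∷ʳ-⊆ (∈-++⁺ˡ p)) ⊆-refl (∧L₁ A B α Π , b)
    in restructure (∷ʳ-⊆ p) ⊆-refl (∧L₂ A B α Π′ , b′)
  toProof (G∧R A B α p d e) =
    let (Π , b) = toProof d
        (Π′ , b′) = toProof e
    in restructure (xs++xs⊆xs _) (∈-∷⁺ʳ p (xs++xs⊆xs _)) (∧R A B α Π Π′ , ⊔-lub b b′)
  toProof {Γ} (G∨L A B α p d e) =
    let (Π , b) = restructure (∷⊆∷ʳ _ Γ) ⊆-refl (toProof d)
        (Π′ , b′) = restructure (∷⊆∷ʳ _ Γ) ⊆-refl (toProof e)
    in restructure (++-⊆ ⊆-refl (∷ʳ-⊆ p)) (xs++xs⊆xs _) (∨L A B α Π Π′ , ⊔-lub b b′)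
  toProof (G∨R A B α p d) =
    let (Π , b) = toProof d
        (Π′ , b′) = restructure ⊆-refl swap-⊆ (∨R₁ A B α Π , b)
    in restructure ⊆-refl (∈-∷⁺ʳ p (∈-∷⁺ʳ p ⊆-refl)) (∨R₂ A B α Π′ , b′)
  toProof {Γ} (G⇒L A B α p d e) =
    let (Π , b) = toProof d
        (Π′ , b′) = restructure (∷⊆∷ʳ _ Γ) ⊆-refl (toProof e)
    in restructure (++-⊆ ⊆-refl (∷ʳ-⊆ p)) (xs++xs⊆xs _) (⇒L A B α Π Π′ , ⊔-lub b b′)
  toProof {Γ} (G⇒R A B α p d) =
    let (Π , b) = restructure (∷⊆∷ʳ _ Γ) ⊆-refl (toProof d)
    in restructure ⊆-refl (∈-∷⁺ʳ p ⊆-refl) (⇒R A B α Π , b)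
  toProof {Γ} (G□L A α β p β-adm w d) =
    let (Π , b) = restructure (∷⊆∷ʳ _ Γ) ⊆-refl (toProof d)
    in restructure (∷ʳ-⊆ p) ⊆-refl (□L A α β β-adm w Π , b)
  toProof (G◇R A α β p β-adm w d) =
    let (Π , b) = toProof d in restructure ⊆-refl (∈-∷⁺ʳ p ⊆-refl) (◇R A α β β-adm w Π , b)
  toProof {Γ} {Δ} (G□R A α p E) =
    let (z , fresh) = fresh-token α (Γ ++ Δ)
        (Π , b) = toProof (E z fresh)
    in restructure ⊆-refl (∈-∷⁺ʳ p ⊆-refl) (□R A α z fresh Π , b)
  toProof {Γ} {Δ} (G◇L A α p E) =
    let (z , fresh) = fresh-token α (Γ ++ Δ)
        (Π , b) = restructure (∷⊆∷ʳ _ Γ) ⊆-refl (toProof (E z fresh))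
    in restructure (∷ʳ-⊆ p) ⊆-refl (◇L A α z fresh Π , b)

-- Removing a p-formula

T-∧⁻ : ∀ {a b} → T (a ∧ b) → T a × T b
T-∧⁻ = Equivalence.to T-∧

eqFm-sound : ∀ A B → T (eqFm A B) → A ≡ B
eqFm-sound (prop p) (prop q) t = cong prop (≡ᵇ⇒≡ p q t)
eqFm-sound (¬′ A) (¬′ B) t = cong ¬′ (eqFm-sound A B t)
eqFm-sound (□′ A) (□′ B) t = cong □′ (eqFm-sound A B t)
eqFm-sound (◇′ A) (◇′ B) t = cong ◇′ (eqFm-sound A B t)
eqFm-sound (A ∧′ B) (C ∧′ D) t = 
  let (tA , tB) = T-∧⁻ t in cong₂ _∧′_ (eqFm-sound A C tA) (eqFm-sound B D tB)
eqFm-sound (A ∨′ B) (C ∨′ D) t = 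
  let (tA , tB) = T-∧⁻ t in cong₂ _∨′_ (eqFm-sound A C tA) (eqFm-sound B D tB)
eqFm-sound (A ⇒′ B) (C ⇒′ D) t = 
  let (tA , tB) = T-∧⁻ t in cong₂ _⇒′_ (eqFm-sound A C tA) (eqFm-sound B D tB)
eqFm-sound (prop _) (¬′ _) ()
eqFm-sound (prop _) (_ ∧′ _) ()
eqFm-sound (prop _) (_ ∨′ _) ()
eqFm-sound (prop _) (_ ⇒′ _) ()
eqFm-sound (prop _) (□′ _) ()
eqFm-sound (prop _) (◇′ _) ()
eqFm-sound (¬′ _) (prop _) ()
eqFm-sound (¬′ _) (_ ∧′ _) ()
eqFm-sound (¬′ _) (_ ∨′ _) ()
eqFm-sound (¬′ _) (_ ⇒′ _) ()
eqFm-sound (¬′ _) (□′ _) ()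
eqFm-sound (¬′ _) (◇′ _) ()
eqFm-sound (_ ∧′ _) (prop _) ()
eqFm-sound (_ ∧′ _) (¬′ _) ()
eqFm-sound (_ ∧′ _) (_ ∨′ _) ()
eqFm-sound (_ ∧′ _) (_ ⇒′ _) ()
eqFm-sound (_ ∧′ _) (□′ _) ()
eqFm-sound (_ ∧′ _) (◇′ _) ()
eqFm-sound (_ ∨′ _) (prop _) ()
eqFm-sound (_ ∨′ _) (¬′ _) ()
eqFm-sound (_ ∨′ _) (_ ∧′ _) ()
eqFm-sound (_ ∨′ _) (_ ⇒′ _) ()
eqFm-sound (_ ∨′ _) (□′ _) ()
eqFm-sound (_ ∨′ _) (◇′ _) ()
eqFm-sound (_ ⇒′ _) (prop _) ()
eqFm-sound (_ ⇒′ _) (¬′ _) ()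
eqFm-sound (_ ⇒′ _) (_ ∧′ _) ()
eqFm-sound (_ ⇒′ _) (_ ∨′ _) ()
eqFm-sound (_ ⇒′ _) (□′ _) ()
eqFm-sound (_ ⇒′ _) (◇′ _) ()
eqFm-sound (□′ _) (prop _) ()
eqFm-sound (□′ _) (¬′ _) ()
eqFm-sound (□′ _) (_ ∧′ _) ()
eqFm-sound (□′ _) (_ ∨′ _) ()
eqFm-sound (□′ _) (_ ⇒′ _) ()
eqFm-sound (□′ _) (◇′ _) ()
eqFm-sound (◇′ _) (prop _) ()
eqFm-sound (◇′ _) (¬′ _) ()
eqFm-sound (◇′ _) (_ ∧′ _) ()
eqFm-sound (◇′ _) (_ ∨′ _) ()
eqFm-sound (◇′ _) (_ ⇒′ _) ()
eqFm-sound (◇′ _) (□′ _) ()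

eqPos-sound : ∀ α β → T (eqPos α β) → α ≡ β
eqPos-sound []      []      _ = refl
eqPos-sound (x ∷ α) (y ∷ β) t =
  let (tx , tα) = T-∧⁻ t in cong₂ _∷_ (≡ᵇ⇒≡ x y tx) (eqPos-sound α β tα)

eqPF-sound : ∀ P Q → eqPF P Q ≡ true → P ≡ Q
eqPF-sound (A ^ α) (B ^ β) e =
  let (tA , tα) = T-∧⁻ (Equivalence.from T-≡ e) in cong₂ _^_ (eqFm-sound A B tA) (eqPos-sound α β tα)

－-⊆ : ∀ Γ P → Γ － P ⊆ Γ
－-⊆ (Q ∷ Γ) P Q′∈ with eqPF Q P
... | true = there (－-⊆ Γ P Q′∈)
－-⊆ (Q ∷ Γ) P (here e)   | false = here e
－-⊆ (Q ∷ Γ) P (there Q′∈) | false = there (－-⊆ Γ P Q′∈)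

⊆∷－ : ∀ Γ P → Γ ⊆ P ∷ (Γ － P)
⊆∷－ (Q ∷ Γ) P (here refl) with eqPF Q P in e
... | true  = here (eqPF-sound Q P e)
... | false = there (here refl)
⊆∷－ (Q ∷ Γ) P (there Q′∈) with eqPF Q P | ⊆∷－ Γ P Q′∈
... | true  | Q′∈′          = Q′∈′
... | false | here e        = here e
... | false | there Q′∈Γ－P = there (there Q′∈Γ－P)

mainTheorem12 : (S : System) (n : ℕ) (A : Fm) (α : Pos) → deg A ≡ n →
    {Γ Δ Γ′ Δ′ : List PF} (Π : Proof S Γ Δ) (Π′ : Proof S Γ′ Δ′) →
    g Π ≤ n → g Π′ ≤ n →
    (α ∈I (Γ ++ (Δ － (A ^ α))) ⊎ α ∈I ((Γ′ － (A ^ α)) ++ (Δ′ － (A ^ α)))) →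
    Σ (Proof S (Γ ++ (Γ′ － (A ^ α))) ((Δ － (A ^ α)) ++ Δ′)) (λ Π″ → g Π″ ≤ n)
mainTheorem12 S n A α deg≡n {Γ} {Δ} {Γ′} {Δ′} Π Π′ gΠ≤n gΠ′≤n side =
  toProof (cut-admissible (≤-reflexive deg≡n) (fromProof Π gΠ≤n) (fromProof Π′ gΠ′≤n) left right)
  where
  left : LeftEmbedding (A ^ α) Γ Δ (Γ ++ (Γ′ － (A ^ α))) ((Δ － (A ^ α)) ++ Δ′)
  left = record
    { ante₁ = xs⊆xs++ys Γ _
    ; succ₁ = ⊆-trans (⊆∷－ Δ (A ^ α)) (∷⁺ʳ _ (xs⊆xs++ys _ Δ′))
    }
  right : RightEmbedding (A ^ α) Γ′ Δ′ (Γ ++ (Γ′ － (A ^ α))) ((Δ － (A ^ α)) ++ Δ′)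
  right = record
    { ante₂  = ⊆-trans (⊆∷－ Γ′ (A ^ α)) (∷⁺ʳ _ (xs⊆ys++xs _ Γ))
    ; succ₂  = xs⊆ys++xs Δ′ _
    ; anchor = [ ∈I-mono (++⁺ (xs⊆xs++ys Γ _) (xs⊆xs++ys _ Δ′))
               , ∈I-mono (++⁺ (xs⊆ys++xs _ Γ) (xs⊆ys++xs Δ′ _ ∘′ －-⊆ Δ′ (A ^ α))) ]′ side
    }
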